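{- For all computations $M,N$ of $\lambda_{\copyright}$: if $M \to_{\copyright}^* N$, then there exists a computation $L$ such that $M (\to^{\mathsf s}_{\copyright})^* L$ and $L (\to^{\neg\mathsf s}_{\copyright})^* N$.
   Context: The computational core $\lambda_{\copyright}$ has values $V,W ::= x \mid \lambda x.M$ and computations $M,N,L ::= \,!V \mid VM$, where $x$ ranges over a countable set of variables; terms are taken up to $\alpha$-renaming, $\mathrm{fv}$ denotes free variables and $M\{V/x\}$ capture-avoiding substitution. The rules (binary relations on computations) are: $\beta_c$: $(\lambda x.M)(!V) \mapsto M\{V/x\}$; $\mathsf{id}$: $(\lambda x.!x)M \mapsto M$; $\sigma$: $(\lambda y.N)((\lambda x.M)L) \mapsto (\lambda x.(\lambda y.N)M)L$ provided $x\notin \mathrm{fv}(N)$; and $\copyright = \beta_c\cup\mathsf{id}\cup\sigma$. Contexts: $C ::= [\,] \mid\, !(\lambda x.C) \mid VC \mid (\lambda x.C)M$; surface contexts: $S ::= [\,] \mid VS \mid (\lambda x.S)M$ (holes are filled with computations). For a rule $\rho$, $\to_\rho$ is its closure under all contexts ($C[R]\to_\rho C[R']$ whenever $R\mapsto_\rho R'$), $\to^{\mathsf s}_\rho$ is its closure under surface contexts, and $\to^{\neg\mathsf s}_\rho$ is its closure under contexts that are not surface contexts. $\to^*$ denotes reflexive–transitive closure. -}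

module Defs where

open import Data.Nat using (ℕ; zero; suc)
open import Data.Fin using (Fin; zero; suc)
open import Data.Empty using (⊥)
open import Relation.Binary.Construct.Closure.ReflexiveTransitive using (Star)

-- Computational core λ©, terms with well-scoped de Bruijn indices
-- (terms up to α-renaming). Val n / Com n: terms with free vars among n.
data Val (n : ℕ) : Set
data Com (n : ℕ) : Set

data Val n where
  var : Fin n → Val n
  lam : Com (suc n) → Val n

data Com n where
  ret : Val n → Com n
  app : Val n → Com n → Com n

Ren : ℕ → ℕ → Set
Ren m n = Fin m → Fin n

extR : ∀ {m n} → Ren m n → Ren (suc m) (suc n)
extR ρ zero    = zero
extR ρ (suc i) = suc (ρ i)

renV : ∀ {m n} → Ren m n → Val m → Val n
renC : ∀ {m n} → Ren m n → Com m → Com n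
renV ρ (var i) = var (ρ i)
renV ρ (lam M) = lam (renC (extR ρ) M)
renC ρ (ret V)   = ret (renV ρ V)
renC ρ (app V M) = app (renV ρ V) (renC ρ M)

wkC : ∀ {n} → Com n → Com (suc n)
wkC = renC suc

-- (weakening of the body N of λy.N past a new outer binder x:
--  the new binder x is inserted *below* y, i.e. at index 1)
wk1C : ∀ {n} → Com (suc n) → Com (suc (suc n))
wk1C = renC (extR suc)

Sub : ℕ → ℕ → Set
Sub m n = Fin m → Val n

extS : ∀ {m n} → Sub m n → Sub (suc m) (suc n)
extS σ zero    = var zero
extS σ (suc i) = renV suc (σ i)

subV : ∀ {m n} → Sub m n → Val m → Val n
subC : ∀ {m n} → Sub m n → Com m → Com n
subV σ (var i) = σ i
subV σ (lam M) = lam (subC (extS σ) M)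
subC σ (ret V)   = ret (subV σ V)
subC σ (app V M) = app (subV σ V) (subC σ M)

single : ∀ {n} → Val n → Sub (suc n) n
single V zero    = V
single V (suc i) = var i

_[_] : ∀ {n} → Com (suc n) → Val n → Com n
M [ V ] = subC (single V) M

-- root rules
-- βc : (λx.M)(!V) ↦ M{V/x}
-- id : (λx.!x) M ↦ M
-- σ  : (λy.N)((λx.M)L) ↦ (λx.(λy.N)M)L, x ∉ fv(N)  (N is weakened by x)
data _↦©_ {n : ℕ} : Com n → Com n → Set where
  βc : ∀ (M : Com (suc n)) (V : Val n) → app (lam M) (ret V) ↦© (M [ V ])
  idr : ∀ (M : Com n) → app (lam (ret (var zero))) M ↦© M
  σr : ∀ (N : Com (suc n)) (M : Com (suc n)) (L : Com n) →
       app (lam N) (app (lam M) L) ↦© app (lam (app (lam (wk1C N)) M)) L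

-- Contexts C ::= [] | !(λx.C) | VC | (λx.C)M, with hole filled by a
-- computation. Ctx n k: outer scope n, hole scope k.
data Ctx (n : ℕ) : ℕ → Set where
  hole   : Ctx n n
  retLam : ∀ {k} → Ctx (suc n) k → Ctx n k
  appR   : ∀ {k} → Val n → Ctx n k → Ctx n k
  appL   : ∀ {k} → Ctx (suc n) k → Com n → Ctx n k

plug : ∀ {n k} → Ctx n k → Com k → Com n
plug hole       R = R
plug (retLam C) R = ret (lam (plug C R))
plug (appR V C) R = app V (plug C R)
plug (appL C M) R = app (lam (plug C R)) M

data Surface {n : ℕ} : ∀ {k} → Ctx n k → Set where
  hole : Surface hole
  appR : ∀ {k} (V : Val n) {C : Ctx n k} → Surface C → Surface (appR V C)
  appL : ∀ {k} {C : Ctx (suc n) k} (M : Com n) → Surface C → Surface (appL C M)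

data _→©_ {n : ℕ} : Com n → Com n → Set where
  step : ∀ {k} (C : Ctx n k) {R R' : Com k} → R ↦© R' → plug C R →© plug C R'

data _→ˢ©_ {n : ℕ} : Com n → Com n → Set where
  step : ∀ {k} (C : Ctx n k) → Surface C → {R R' : Com k} → R ↦© R' →
         plug C R →ˢ© plug C R'

data _→¬ˢ©_ {n : ℕ} : Com n → Com n → Set where
  step : ∀ {k} (C : Ctx n k) → (Surface C → ⊥) → {R R' : Com k} → R ↦© R' →
         plug C R →¬ˢ© plug C R'

_→©*_ : ∀ {n} → Com n → Com n → Set
_→©*_ = Star _→©_

_→ˢ©*_ : ∀ {n} → Com n → Com n → Set
_→ˢ©*_ = Star _→ˢ©_

_→¬ˢ©*_ : ∀ {n} → Com n → Com n → Set
_→¬ˢ©*_ = Star _→¬ˢ©_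

module Submission where

-- Split every step into a surface step (syntax-directed relation ⟶ₛ) or an
-- internal one, and collect internal steps into a parallel relation ⇛ᵢ.
-- Postponement: ⇛ᵢ followed by a surface step can be replaced by surface
-- steps followed by ⇛ᵢ. The only non-routine cases are the root rules, where
-- βc needs substitutivity of ⇛ᵢ; under !(λx.·) no step is surface, so there a
-- value may reduce by surface steps of its body followed by ⇛ᵢ, which keeps
-- ⇛ᵢ stable under substitution. Induction on M →©* N then moves every
-- surface step to the front, and each ⇛ᵢ unfolds into non-surface steps.

open import Defs
open import Data.Nat using (ℕ; suc)
open import Data.Fin using (zero; suc)
open import Data.Product using (Σ; _×_; _,_)
open import Data.Sum using (_⊎_; inj₁; inj₂)
open import Function using (_∘_; id)
open import Relation.Binary.PropositionalEquality
  using (_≡_; refl; sym; trans; cong; cong₂; module ≡-Reasoning)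
open import Relation.Binary.Construct.Closure.ReflexiveTransitive
  using (Star; ε; _◅_; _◅◅_; gmap)

extR-cong : ∀ {m n} {ρ ρ' : Ren m n} → (∀ i → ρ i ≡ ρ' i) → ∀ i → extR ρ i ≡ extR ρ' i
extR-cong h zero    = refl
extR-cong h (suc i) = cong suc (h i)

renV-cong : ∀ {m n} {ρ ρ' : Ren m n} → (∀ i → ρ i ≡ ρ' i) → ∀ V → renV ρ V ≡ renV ρ' V
renC-cong : ∀ {m n} {ρ ρ' : Ren m n} → (∀ i → ρ i ≡ ρ' i) → ∀ M → renC ρ M ≡ renC ρ' M
renV-cong h (var i)   = cong var (h i)
renV-cong h (lam M)   = cong lam (renC-cong (extR-cong h) M)
renC-cong h (ret V)   = cong ret (renV-cong h V)
renC-cong h (app V M) = cong₂ app (renV-cong h V) (renC-cong h M)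

extS-cong : ∀ {m n} {σ σ' : Sub m n} → (∀ i → σ i ≡ σ' i) → ∀ i → extS σ i ≡ extS σ' i
extS-cong h zero    = refl
extS-cong h (suc i) = cong (renV suc) (h i)

subV-cong : ∀ {m n} {σ σ' : Sub m n} → (∀ i → σ i ≡ σ' i) → ∀ V → subV σ V ≡ subV σ' V
subC-cong : ∀ {m n} {σ σ' : Sub m n} → (∀ i → σ i ≡ σ' i) → ∀ M → subC σ M ≡ subC σ' M
subV-cong h (var i)   = h i
subV-cong h (lam M)   = cong lam (subC-cong (extS-cong h) M)
subC-cong h (ret V)   = cong ret (subV-cong h V)
subC-cong h (app V M) = cong₂ app (subV-cong h V) (subC-cong h M)

renV-∘ : ∀ {l m n} (ρ : Ren m n) (ρ' : Ren l m) V → renV ρ (renV ρ' V) ≡ renV (ρ ∘ ρ') V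
renC-∘ : ∀ {l m n} (ρ : Ren m n) (ρ' : Ren l m) M → renC ρ (renC ρ' M) ≡ renC (ρ ∘ ρ') M
renV-∘ ρ ρ' (var i)   = refl
renV-∘ ρ ρ' (lam M)   = cong lam (trans (renC-∘ (extR ρ) (extR ρ') M) (renC-cong ext M))
  where
  ext : ∀ i → extR ρ (extR ρ' i) ≡ extR (ρ ∘ ρ') i
  ext zero    = refl
  ext (suc i) = refl
renC-∘ ρ ρ' (ret V)   = cong ret (renV-∘ ρ ρ' V)
renC-∘ ρ ρ' (app V M) = cong₂ app (renV-∘ ρ ρ' V) (renC-∘ ρ ρ' M)

subV-renV : ∀ {l m n} (σ : Sub m n) (ρ : Ren l m) V → subV σ (renV ρ V) ≡ subV (σ ∘ ρ) V
subC-renC : ∀ {l m n} (σ : Sub m n) (ρ : Ren l m) M → subC σ (renC ρ M) ≡ subC (σ ∘ ρ) M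
subV-renV σ ρ (var i)   = refl
subV-renV σ ρ (lam M)   = cong lam (trans (subC-renC (extS σ) (extR ρ) M) (subC-cong ext M))
  where
  ext : ∀ i → extS σ (extR ρ i) ≡ extS (σ ∘ ρ) i
  ext zero    = refl
  ext (suc i) = refl
subC-renC σ ρ (ret V)   = cong ret (subV-renV σ ρ V)
subC-renC σ ρ (app V M) = cong₂ app (subV-renV σ ρ V) (subC-renC σ ρ M)

renV-subV : ∀ {l m n} (ρ : Ren m n) (σ : Sub l m) V → renV ρ (subV σ V) ≡ subV (renV ρ ∘ σ) V
renC-subC : ∀ {l m n} (ρ : Ren m n) (σ : Sub l m) M → renC ρ (subC σ M) ≡ subC (renV ρ ∘ σ) M
renV-subV ρ σ (var i)   = refl
renV-subV ρ σ (lam M)   = cong lam (trans (renC-subC (extR ρ) (extS σ) M) (subC-cong ext M))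
  where
  ext : ∀ i → renV (extR ρ) (extS σ i) ≡ extS (renV ρ ∘ σ) i
  ext zero    = refl
  ext (suc i) = trans (renV-∘ (extR ρ) suc (σ i)) (sym (renV-∘ suc ρ (σ i)))
renC-subC ρ σ (ret V)   = cong ret (renV-subV ρ σ V)
renC-subC ρ σ (app V M) = cong₂ app (renV-subV ρ σ V) (renC-subC ρ σ M)

subV-∘ : ∀ {l m n} (σ : Sub m n) (τ : Sub l m) V → subV σ (subV τ V) ≡ subV (subV σ ∘ τ) V
subC-∘ : ∀ {l m n} (σ : Sub m n) (τ : Sub l m) M → subC σ (subC τ M) ≡ subC (subV σ ∘ τ) M
subV-∘ σ τ (var i)   = refl
subV-∘ σ τ (lam M)   = cong lam (trans (subC-∘ (extS σ) (extS τ) M) (subC-cong ext M))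
  where
  ext : ∀ i → subV (extS σ) (extS τ i) ≡ extS (subV σ ∘ τ) i
  ext zero    = refl
  ext (suc i) = trans (subV-renV (extS σ) suc (τ i)) (sym (renV-subV suc σ (τ i)))
subC-∘ σ τ (ret V)   = cong ret (subV-∘ σ τ V)
subC-∘ σ τ (app V M) = cong₂ app (subV-∘ σ τ V) (subC-∘ σ τ M)

subV-id : ∀ {n} (V : Val n) → subV var V ≡ V
subC-id : ∀ {n} (M : Com n) → subC var M ≡ M
subV-id (var i)   = refl
subV-id (lam M)   = cong lam (trans (subC-cong ext M) (subC-id M))
  where
  ext : ∀ i → extS var i ≡ var i
  ext zero    = refl
  ext (suc i) = refl
subC-id (ret V)   = cong ret (subV-id V)
subC-id (app V M) = cong₂ app (subV-id V) (subC-id M)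

renC-[] : ∀ {m n} (ρ : Ren m n) (M : Com (suc m)) V →
  renC ρ (M [ V ]) ≡ renC (extR ρ) M [ renV ρ V ]
renC-[] ρ M V = begin
  renC ρ (M [ V ])                       ≡⟨ renC-subC ρ (single V) M ⟩
  subC (renV ρ ∘ single V) M             ≡⟨ subC-cong pointwise M ⟩
  subC (single (renV ρ V) ∘ extR ρ) M    ≡⟨ sym (subC-renC (single (renV ρ V)) (extR ρ) M) ⟩
  renC (extR ρ) M [ renV ρ V ]           ∎
  where
  open ≡-Reasoning
  pointwise : ∀ i → renV ρ (single V i) ≡ single (renV ρ V) (extR ρ i)
  pointwise zero    = refl
  pointwise (suc i) = refl

subC-[] : ∀ {m n} (σ : Sub m n) (M : Com (suc m)) V →
  subC σ (M [ V ]) ≡ subC (extS σ) M [ subV σ V ]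
subC-[] σ M V = begin
  subC σ (M [ V ])                              ≡⟨ subC-∘ σ (single V) M ⟩
  subC (subV σ ∘ single V) M                    ≡⟨ subC-cong pointwise M ⟩
  subC (subV (single (subV σ V)) ∘ extS σ) M    ≡⟨ sym (subC-∘ (single (subV σ V)) (extS σ) M) ⟩
  subC (extS σ) M [ subV σ V ]                  ∎
  where
  open ≡-Reasoning
  pointwise : ∀ i → subV σ (single V i) ≡ subV (single (subV σ V)) (extS σ i)
  pointwise zero    = refl
  pointwise (suc i) = sym (trans (subV-renV (single (subV σ V)) suc (σ i)) (subV-id (σ i)))

renC-wk1C : ∀ {m n} (ρ : Ren m n) (N : Com (suc m)) →
  renC (extR (extR ρ)) (wk1C N) ≡ wk1C (renC (extR ρ) N)
renC-wk1C ρ N = trans (renC-∘ (extR (extR ρ)) (extR suc) N)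
  (trans (renC-cong pointwise N) (sym (renC-∘ (extR suc) (extR ρ) N)))
  where
  pointwise : ∀ i → extR (extR ρ) (extR suc i) ≡ extR suc (extR ρ i)
  pointwise zero    = refl
  pointwise (suc i) = refl

subC-wk1C : ∀ {m n} (σ : Sub m n) (N : Com (suc m)) →
  subC (extS (extS σ)) (wk1C N) ≡ wk1C (subC (extS σ) N)
subC-wk1C σ N = trans (subC-renC (extS (extS σ)) (extR suc) N)
  (trans (subC-cong pointwise N) (sym (renC-subC (extR suc) (extS σ) N)))
  where
  pointwise : ∀ i → extS (extS σ) (extR suc i) ≡ renV (extR suc) (extS σ i)
  pointwise zero    = refl
  pointwise (suc i) = trans (renV-∘ suc suc (σ i)) (sym (renV-∘ (extR suc) suc (σ i)))

↦©-renC : ∀ {m n} (ρ : Ren m n) {R R' : Com m} → R ↦© R' → renC ρ R ↦© renC ρ R'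
↦©-renC ρ (βc M V)   rewrite renC-[] ρ M V = βc _ _
↦©-renC ρ (idr M)    = idr _
↦©-renC ρ (σr N M L) rewrite renC-wk1C ρ N = σr _ _ _

↦©-subC : ∀ {m n} (σ : Sub m n) {R R' : Com m} → R ↦© R' → subC σ R ↦© subC σ R'
↦©-subC σ (βc M V)   rewrite subC-[] σ M V = βc _ _
↦©-subC σ (idr M)    = idr _
↦©-subC σ (σr N M L) rewrite subC-wk1C σ N = σr _ _ _

data _⟶ₛ_ {n : ℕ} : Com n → Com n → Set where
  root : ∀ {R R'} → R ↦© R' → R ⟶ₛ R'
  arg  : ∀ {M M'} (V : Val n) → M ⟶ₛ M' → app V M ⟶ₛ app V M'
  body : ∀ {P P'} (M : Com n) → P ⟶ₛ P' → app (lam P) M ⟶ₛ app (lam P') M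

_⟶ₛ*_ : ∀ {n} → Com n → Com n → Set
_⟶ₛ*_ = Star _⟶ₛ_

arg* : ∀ {n} (V : Val n) {M M' : Com n} → M ⟶ₛ* M' → app V M ⟶ₛ* app V M'
arg* V = gmap (app V) (arg V)

body* : ∀ {n} (M : Com n) {P P' : Com (suc n)} → P ⟶ₛ* P' → app (lam P) M ⟶ₛ* app (lam P') M
body* M = gmap (λ P → app (lam P) M) (body M)

⟶ₛ-renC : ∀ {m n} (ρ : Ren m n) {M M' : Com m} → M ⟶ₛ M' → renC ρ M ⟶ₛ renC ρ M'
⟶ₛ-renC ρ (root r)   = root (↦©-renC ρ r)
⟶ₛ-renC ρ (arg V s)  = arg _ (⟶ₛ-renC ρ s)
⟶ₛ-renC ρ (body M s) = body _ (⟶ₛ-renC (extR ρ) s)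

⟶ₛ-subC : ∀ {m n} (σ : Sub m n) {M M' : Com m} → M ⟶ₛ M' → subC σ M ⟶ₛ subC σ M'
⟶ₛ-subC σ (root r)   = root (↦©-subC σ r)
⟶ₛ-subC σ (arg V s)  = arg _ (⟶ₛ-subC σ s)
⟶ₛ-subC σ (body M s) = body _ (⟶ₛ-subC (extS σ) s)

-- V ⇛ᶠ V' is for values in function position, whose body is a surface
-- position; V ⇛ᵛ V' for returned values, whose body may reduce arbitrarily.
-- M ⇝ N is the factorised form "surface steps, then one ⇛ᵢ" being proved.
data _⇛ᵢ_ {n : ℕ} : Com n → Com n → Set
data _⇛ᶠ_ {n : ℕ} : Val n → Val n → Set
data _⇛ᵛ_ {n : ℕ} : Val n → Val n → Set
data _⇝_  {n : ℕ} : Com n → Com n → Set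

data _⇛ᵢ_ {n} where
  ret : ∀ {V V'} → V ⇛ᵛ V' → ret V ⇛ᵢ ret V'
  app : ∀ {V V' M M'} → V ⇛ᶠ V' → M ⇛ᵢ M' → app V M ⇛ᵢ app V' M'

data _⇛ᶠ_ {n} where
  var : ∀ i → var i ⇛ᶠ var i
  lam : ∀ {P P'} → P ⇛ᵢ P' → lam P ⇛ᶠ lam P'

data _⇛ᵛ_ {n} where
  var : ∀ i → var i ⇛ᵛ var i
  lam : ∀ {P P'} → P ⇝ P' → lam P ⇛ᵛ lam P'

data _⇝_ {n} where
  _⨾_ : ∀ {M L N} → M ⟶ₛ* L → L ⇛ᵢ N → M ⇝ N

⇛ᵢ-refl : ∀ {n} (M : Com n) → M ⇛ᵢ M
⇛ᶠ-refl : ∀ {n} (V : Val n) → V ⇛ᶠ V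
⇛ᵛ-refl : ∀ {n} (V : Val n) → V ⇛ᵛ V
⇛ᵢ-refl (ret V)   = ret (⇛ᵛ-refl V)
⇛ᵢ-refl (app V M) = app (⇛ᶠ-refl V) (⇛ᵢ-refl M)
⇛ᶠ-refl (var i)   = var i
⇛ᶠ-refl (lam P)   = lam (⇛ᵢ-refl P)
⇛ᵛ-refl (var i)   = var i
⇛ᵛ-refl (lam P)   = lam (ε ⨾ ⇛ᵢ-refl P)

⇛ᵢ⇒⇝ : ∀ {n} {M N : Com n} → M ⇛ᵢ N → M ⇝ N
⇛ᵢ⇒⇝ m = ε ⨾ m

⟶ₛ*-⇝ : ∀ {n} {M L N : Com n} → M ⟶ₛ* L → L ⇝ N → M ⇝ N
⟶ₛ*-⇝ ss (ts ⨾ m) = (ss ◅◅ ts) ⨾ m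

⇝-appLam : ∀ {n} {P P' : Com (suc n)} {M M' : Com n} →
  P ⇝ P' → M ⇝ M' → app (lam P) M ⇝ app (lam P') M'
⇝-appLam {M = M} (ss ⨾ p) (ts ⨾ m) = (body* M ss ◅◅ arg* _ ts) ⨾ app (lam p) m

⇝-app : ∀ {n} {V V' : Val n} {M M' : Com n} → V ⇛ᵛ V' → M ⇝ M' → app V M ⇝ app V' M'
⇝-app (var i) (ts ⨾ m) = arg* (var i) ts ⨾ app (var i) m
⇝-app (lam p) m        = ⇝-appLam p m

⇛ᵢ-renC : ∀ {m n} (ρ : Ren m n) {M M' : Com m} → M ⇛ᵢ M' → renC ρ M ⇛ᵢ renC ρ M'
⇛ᶠ-renV : ∀ {m n} (ρ : Ren m n) {V V' : Val m} → V ⇛ᶠ V' → renV ρ V ⇛ᶠ renV ρ V'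
⇛ᵛ-renV : ∀ {m n} (ρ : Ren m n) {V V' : Val m} → V ⇛ᵛ V' → renV ρ V ⇛ᵛ renV ρ V'
⇛ᵢ-renC ρ (ret v)   = ret (⇛ᵛ-renV ρ v)
⇛ᵢ-renC ρ (app v m) = app (⇛ᶠ-renV ρ v) (⇛ᵢ-renC ρ m)
⇛ᶠ-renV ρ (var i)   = var (ρ i)
⇛ᶠ-renV ρ (lam p)   = lam (⇛ᵢ-renC (extR ρ) p)
⇛ᵛ-renV ρ (var i)   = var (ρ i)
⇛ᵛ-renV ρ (lam (ss ⨾ p)) =
  lam (gmap (renC (extR ρ)) (⟶ₛ-renC (extR ρ)) ss ⨾ ⇛ᵢ-renC (extR ρ) p)

_⇛ˢ_ : ∀ {m n} → Sub m n → Sub m n → Set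
σ ⇛ˢ σ' = ∀ i → σ i ⇛ᵛ σ' i

extS-⇛ˢ : ∀ {m n} {σ σ' : Sub m n} → σ ⇛ˢ σ' → extS σ ⇛ˢ extS σ'
extS-⇛ˢ h zero    = var zero
extS-⇛ˢ h (suc i) = ⇛ᵛ-renV suc (h i)

single-⇛ˢ : ∀ {n} {V V' : Val n} → V ⇛ᵛ V' → single V ⇛ˢ single V'
single-⇛ˢ v zero    = v
single-⇛ˢ v (suc i) = var i

-- A variable in function position may be replaced by a λ, turning internal
-- steps of the substituted value into surface ones; hence ⇝ rather than ⇛ᵢ.
⇛ᵢ-subC : ∀ {m n} {σ σ' : Sub m n} → σ ⇛ˢ σ' → {M M' : Com m} → M ⇛ᵢ M' →
  subC σ M ⇝ subC σ' M'
⇛ᵛ-subV : ∀ {m n} {σ σ' : Sub m n} → σ ⇛ˢ σ' → {V V' : Val m} → V ⇛ᵛ V' →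
  subV σ V ⇛ᵛ subV σ' V'
⇛ᵢ-subC h (ret v)           = ⇛ᵢ⇒⇝ (ret (⇛ᵛ-subV h v))
⇛ᵢ-subC h (app (var i) m)   = ⇝-app (h i) (⇛ᵢ-subC h m)
⇛ᵢ-subC h (app (lam p) m)   = ⇝-appLam (⇛ᵢ-subC (extS-⇛ˢ h) p) (⇛ᵢ-subC h m)
⇛ᵛ-subV h (var i)           = h i
⇛ᵛ-subV {σ = σ} h (lam (ss ⨾ p)) =
  lam (⟶ₛ*-⇝ (gmap (subC (extS σ)) (⟶ₛ-subC (extS σ)) ss) (⇛ᵢ-subC (extS-⇛ˢ h) p))

⇛ᵢ-⟶ₛ-postpone : ∀ {n} {M L N : Com n} → M ⇛ᵢ L → L ⟶ₛ N → M ⇝ N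
⇛ᵢ-⟶ₛ-postpone (app (lam p) (ret v)) (root (βc _ _)) =
  ⟶ₛ*-⇝ (root (βc _ _) ◅ ε) (⇛ᵢ-subC (single-⇛ˢ v) p)
⇛ᵢ-⟶ₛ-postpone (app (lam (ret (var zero))) m) (root (idr _)) = (root (idr _) ◅ ε) ⨾ m
⇛ᵢ-⟶ₛ-postpone (app (lam p) (app (lam q) m)) (root (σr _ _ _)) =
  (root (σr _ _ _) ◅ ε) ⨾ app (lam (app (lam (⇛ᵢ-renC (extR suc) p)) q)) m
⇛ᵢ-⟶ₛ-postpone (app v m) (arg _ s) with ⇛ᵢ-⟶ₛ-postpone m s
... | ts ⨾ m' = arg* _ ts ⨾ app v m'
⇛ᵢ-⟶ₛ-postpone (app (lam p) m) (body _ s) with ⇛ᵢ-⟶ₛ-postpone p s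
... | ts ⨾ p' = body* _ ts ⨾ app (lam p') m

⇛ᵢ-⟶ₛ*-postpone : ∀ {n} {M L N : Com n} → M ⇛ᵢ L → L ⟶ₛ* N → M ⇝ N
⇛ᵢ-⟶ₛ*-postpone m ε        = ⇛ᵢ⇒⇝ m
⇛ᵢ-⟶ₛ*-postpone m (s ◅ ss) with ⇛ᵢ-⟶ₛ-postpone m s
... | ts ⨾ m' = ⟶ₛ*-⇝ ts (⇛ᵢ-⟶ₛ*-postpone m' ss)


→©-surface-or-internal : ∀ {n k} (C : Ctx n k) {R R' : Com k} → R ↦© R' →
  (plug C R ⟶ₛ plug C R') ⊎ (plug C R ⇛ᵢ plug C R')
→©-surface-or-internal hole r = inj₁ (root r)
→©-surface-or-internal (retLam C) r with →©-surface-or-internal C r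
... | inj₁ s = inj₂ (ret (lam ((s ◅ ε) ⨾ ⇛ᵢ-refl _)))
... | inj₂ m = inj₂ (ret (lam (ε ⨾ m)))
→©-surface-or-internal (appR V C) r with →©-surface-or-internal C r
... | inj₁ s = inj₁ (arg V s)
... | inj₂ m = inj₂ (app (⇛ᶠ-refl V) m)
→©-surface-or-internal (appL C M) r with →©-surface-or-internal C r
... | inj₁ s = inj₁ (body M s)
... | inj₂ m = inj₂ (app (lam m) (⇛ᵢ-refl M))

factorise : ∀ {n} {M N : Com n} → M →©* N → Σ (Com n) λ L → (M ⟶ₛ* L) × Star _⇛ᵢ_ L N
factorise ε = _ , ε , ε
factorise (step C r ◅ rs) with factorise rs | →©-surface-or-internal C r
... | L , ss , ms | inj₁ s = L , s ◅ ss , ms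
... | L , ss , ms | inj₂ m with ⇛ᵢ-⟶ₛ*-postpone m ss
...   | ts ⨾ m' = _ , ts , m' ◅ ms

⟶ₛ⇒→ˢ© : ∀ {n} {M M' : Com n} → M ⟶ₛ M' → M →ˢ© M'
⟶ₛ⇒→ˢ© (root r) = step hole hole r
⟶ₛ⇒→ˢ© (arg V s) with ⟶ₛ⇒→ˢ© s
... | step C sC r = step (appR V C) (appR V sC) r
⟶ₛ⇒→ˢ© (body M s) with ⟶ₛ⇒→ˢ© s
... | step C sC r = step (appL C M) (appL M sC) r

→¬ˢ©-retLam : ∀ {n} {P P' : Com (suc n)} → P →© P' → ret (lam P) →¬ˢ© ret (lam P')
→¬ˢ©-retLam (step C r) = step (retLam C) (λ ()) r

→¬ˢ©-appR : ∀ {n} (V : Val n) {M M' : Com n} → M →¬ˢ© M' → app V M →¬ˢ© app V M'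
→¬ˢ©-appR V (step C ¬sC r) = step (appR V C) (λ { (appR _ sC) → ¬sC sC }) r

→¬ˢ©-appL : ∀ {n} (M : Com n) {P P' : Com (suc n)} → P →¬ˢ© P' →
  app (lam P) M →¬ˢ© app (lam P') M
→¬ˢ©-appL M (step C ¬sC r) = step (appL C M) (λ { (appL _ sC) → ¬sC sC }) r

⟶ₛ⇒→© : ∀ {n} {M M' : Com n} → M ⟶ₛ M' → M →© M'
⟶ₛ⇒→© s with ⟶ₛ⇒→ˢ© s
... | step C _ r = step C r

→¬ˢ©⇒→© : ∀ {n} {M M' : Com n} → M →¬ˢ© M' → M →© M'
→¬ˢ©⇒→© (step C _ r) = step C r

⇛ᵢ⇒→¬ˢ©* : ∀ {n} {M M' : Com n} → M ⇛ᵢ M' → M →¬ˢ©* M'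
⇛ᵢ⇒→¬ˢ©* (ret (var i))          = ε
⇛ᵢ⇒→¬ˢ©* (ret (lam (ss ⨾ p)))   =
  gmap (λ P → ret (lam P)) (→¬ˢ©-retLam ∘ ⟶ₛ⇒→©) ss ◅◅
  gmap (λ P → ret (lam P)) (→¬ˢ©-retLam ∘ →¬ˢ©⇒→©) (⇛ᵢ⇒→¬ˢ©* p)
⇛ᵢ⇒→¬ˢ©* (app (var i) m)        = gmap (app (var i)) (→¬ˢ©-appR (var i)) (⇛ᵢ⇒→¬ˢ©* m)
⇛ᵢ⇒→¬ˢ©* (app {M = M} (lam {P' = P'} p) m) =
  gmap (λ P → app (lam P) M) (→¬ˢ©-appL M) (⇛ᵢ⇒→¬ˢ©* p) ◅◅
  gmap (app (lam P')) (→¬ˢ©-appR (lam P')) (⇛ᵢ⇒→¬ˢ©* m)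

⇛ᵢ*⇒→¬ˢ©* : ∀ {n} {M M' : Com n} → Star _⇛ᵢ_ M M' → M →¬ˢ©* M'
⇛ᵢ*⇒→¬ˢ©* ε        = ε
⇛ᵢ*⇒→¬ˢ©* (m ◅ ms) = ⇛ᵢ⇒→¬ˢ©* m ◅◅ ⇛ᵢ*⇒→¬ˢ©* ms

mainTheorem1 : ∀ {n : ℕ} (M N : Com n) → M →©* N →
    Σ (Com n) (λ L → (M →ˢ©* L) × (L →¬ˢ©* N))
mainTheorem1 M N red with factorise red
... | L , ss , ms = L , gmap id ⟶ₛ⇒→ˢ© ss , ⇛ᵢ*⇒→¬ˢ©* ms
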